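{- Let $n,n'\in\mathbb{N}^+$, $\rho\in[0,1]^n$, $\rho'\in[0,1]^{n'}$. Then for all $b,b'\in\{0,1\}$, $$E^{bb'}_{n+n'}(\rho,\rho')=E^{b0}_n(\rho)\,E^{1b'}_{n'}(\rho')+E^{b1}_n(\rho)\,E^{0b'}_{n'}(\rho')-E^{b0}_n(\rho)\,E^{0b'}_{n'}(\rho'),$$ where $(\rho,\rho')$ is the concatenated tuple.
   Context: For $n\in\mathbb{N}^+$, $P_n$ is the path with vertices $v_0,\ldots,v_n$ and edges $\{v_j,v_{j+1}\}$, $0\leq j\leq n-1$. For $\rho\in[0,1]^n$, consider the random edge subset $E'$ of $P_n$ where edge $\{v_j,v_{j+1}\}$ is kept independently with probability $\rho_j$. For $b,b'\in\{0,1\}$, $E^{bb'}_n(\rho)$ denotes the probability that every vertex of $P_n$ is incident to an edge of $E'$, except that $v_0$ is exempt if $b=1$ and $v_n$ is exempt if $b'=1$. -}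

module Defs where

open import Level using (Level)
open import Data.Bool using (Bool; true; false; _∧_; _∨_; if_then_else_)
open import Data.Nat using (ℕ; zero; suc)
open import Data.Vec using (Vec; []; _∷_)
open import Data.List using (List; []; _∷_; _++_; map; foldr)
open import Algebra.Bundles using (CommutativeRing)

-- All edge subsets of a path with n edges, as characteristic vectors
-- (entry j = true iff edge {v_j, v_{j+1}} is kept).
allSubsets : (n : ℕ) → List (Vec Bool n)
allSubsets zero = [] ∷ []
allSubsets (suc n) = map (true ∷_) (allSubsets n) ++ map (false ∷_) (allSubsets n)

-- covers b b' S : every vertex v_0..v_n of the path is incident to a kept
-- edge of S, except v_0 exempt if b = true and v_n exempt if b' = true.
-- Recursion: v_0 is fine iff b ∨ S_0; then v_1 (now the first vertex of the
-- remaining path) is already covered iff S_0 holds.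
covers : {n : ℕ} → Bool → Bool → Vec Bool (suc n) → Bool
covers b b' (x ∷ []) = (b ∨ x) ∧ (x ∨ b')
covers b b' (x ∷ y ∷ xs) = (b ∨ x) ∧ covers x b' (y ∷ xs)

module _ {c ℓ : Level} (R : CommutativeRing c ℓ) where
  open CommutativeRing R

  weight : {n : ℕ} → Vec Carrier n → Vec Bool n → Carrier
  weight [] [] = 1#
  weight (p ∷ ρ) (s ∷ S) = (if s then p else (1# - p)) * weight ρ S

  E : Bool → Bool → {m : ℕ} → Vec Carrier (suc m) → Carrier
  E b b' {m} ρ =
    foldr _+_ 0#
      (map (λ S → (if covers b b' S then 1# else 0#) * weight ρ S)
           (allSubsets (suc m)))

-- Condition on the first edge: keeping it (weight p) covers v₀ and leaves v₁
-- exempt, dropping it (weight 1 − p, allowed only if v₀ is exempt) leaves v₁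
-- to be covered by the rest.  So E^{b b'}(p ∷ ρ) is the same linear
-- combination of E^{1 b'}(ρ) and E^{0 b'}(ρ) for every b'.  Gluing a path
-- ρ' at the far end of ρ is linear in the pair (E^{1 b'}(ρ'), E^{0 b'}(ρ')),
-- and the single-edge case fixes the coefficients, which by induction on the
-- length of ρ are E^{b0}(ρ) and E^{b1}(ρ) − E^{b0}(ρ).
module Submission where

open import Defs
open import Level using (Level)
open import Data.Bool using (Bool; true; false; if_then_else_)
open import Data.Nat using (ℕ; suc)
open import Data.Vec using (Vec; _++_; []; _∷_)
open import Data.List as List using (List; map; foldr)
open import Data.List.Properties using (map-++; map-∘)
open import Algebra.Bundles using (CommutativeRing)
open import Relation.Binary.PropositionalEquality using (cong; cong₂)
import Relation.Binary.PropositionalEquality as ≡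
import Algebra.Properties.CommutativeSemigroup as CommutativeSemigroupProperties
import Algebra.Properties.Group as GroupProperties
import Algebra.Solver.Ring.NaturalCoefficients.Default as SemiringSolver
import Relation.Binary.Reasoning.Setoid as SetoidReasoning

module _ {c ℓ : Level} (R : CommutativeRing c ℓ) where
  open CommutativeRing R
  open SetoidReasoning setoid
  open CommutativeSemigroupProperties *-commutativeSemigroup using (x∙yz≈y∙xz)
  open SemiringSolver commutativeSemiring using (solve; _:+_; _:*_; _:=_)

  sum : List Carrier → Carrier
  sum = foldr _+_ 0#

  sum-++ : ∀ xs ys → sum (xs List.++ ys) ≈ sum xs + sum ys
  sum-++ List.[]       ys = sym (+-identityˡ (sum ys))
  sum-++ (x List.∷ xs) ys = trans (+-congˡ (sum-++ xs ys)) (sym (+-assoc x (sum xs) (sum ys)))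

  sum-map-scaled : ∀ {A : Set} {f g : A → Carrier} k xs → (∀ x → f x ≈ k * g x) →
                   sum (map f xs) ≈ k * sum (map g xs)
  sum-map-scaled k List.[]       f≈kg = sym (zeroʳ k)
  sum-map-scaled k (x List.∷ xs) f≈kg =
    trans (+-cong (f≈kg x) (sum-map-scaled k xs f≈kg)) (sym (distribˡ k _ _))

  coveredWeight : Bool → Bool → {m : ℕ} → Vec Carrier (suc m) → Vec Bool (suc m) → Carrier
  coveredWeight b b' ρ S = (if covers b b' S then 1# else 0#) * weight R ρ S

  -- The weight of dropping the first edge: admissible only when v₀ is exempt.
  omitWeight : Bool → Carrier → Carrier
  omitWeight true  p = 1# - p
  omitWeight false p = 0#

  coveredWeight-true∷ : ∀ b b' {m} p (ρ : Vec Carrier (suc m)) S →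
    coveredWeight b b' (p ∷ ρ) (true ∷ S) ≈ p * coveredWeight true b' ρ S
  coveredWeight-true∷ true  b' p ρ (_ ∷ _) = x∙yz≈y∙xz _ p _
  coveredWeight-true∷ false b' p ρ (_ ∷ _) = x∙yz≈y∙xz _ p _

  coveredWeight-false∷ : ∀ b b' {m} p (ρ : Vec Carrier (suc m)) S →
    coveredWeight b b' (p ∷ ρ) (false ∷ S) ≈ omitWeight b p * coveredWeight false b' ρ S
  coveredWeight-false∷ true  b' p ρ (_ ∷ _) = x∙yz≈y∙xz _ (1# - p) _
  coveredWeight-false∷ false b' p ρ (_ ∷ _) = trans (zeroˡ _) (sym (zeroˡ _))

  E-∷ : ∀ b b' {m} p (ρ : Vec Carrier (suc m)) →
        E R b b' (p ∷ ρ) ≈ p * E R true b' ρ + omitWeight b p * E R false b' ρ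
  E-∷ b b' {m} p ρ = begin
    sum (map f (map (true ∷_) Ss List.++ map (false ∷_) Ss))
      ≡⟨ cong sum (map-++ f (map (true ∷_) Ss) (map (false ∷_) Ss)) ⟩
    sum (map f (map (true ∷_) Ss) List.++ map f (map (false ∷_) Ss))
      ≈⟨ sum-++ (map f (map (true ∷_) Ss)) (map f (map (false ∷_) Ss)) ⟩
    sum (map f (map (true ∷_) Ss)) + sum (map f (map (false ∷_) Ss))
      ≡⟨ cong₂ (λ us vs → sum us + sum vs) (≡.sym (map-∘ Ss)) (≡.sym (map-∘ Ss)) ⟩
    sum (map (λ S → f (true ∷ S)) Ss) + sum (map (λ S → f (false ∷ S)) Ss)
      ≈⟨ +-cong (sum-map-scaled p Ss (coveredWeight-true∷ b b' p ρ))
                (sum-map-scaled (omitWeight b p) Ss (coveredWeight-false∷ b b' p ρ)) ⟩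
    p * E R true b' ρ + omitWeight b p * E R false b' ρ ∎
    where
      Ss : List (Vec Bool (suc m))
      Ss = allSubsets (suc m)
      f : Vec Bool (suc (suc m)) → Carrier
      f = coveredWeight b b' (p ∷ ρ)

  1*[x*1]≈x : ∀ x → 1# * (x * 1#) ≈ x
  1*[x*1]≈x x = trans (*-identityˡ (x * 1#)) (*-identityʳ x)

  E-single-false : ∀ b p → E R b false (p ∷ []) ≈ p
  E-single-false true  p =
    trans (+-cong (1*[x*1]≈x p) (trans (+-identityʳ _) (zeroˡ _))) (+-identityʳ p)
  E-single-false false p =
    trans (+-cong (1*[x*1]≈x p) (trans (+-identityʳ _) (zeroˡ _))) (+-identityʳ p)

  E-single-true : ∀ b p → E R b true (p ∷ []) ≈ p + omitWeight b p
  E-single-true true  p = +-cong (1*[x*1]≈x p) (trans (+-identityʳ _) (1*[x*1]≈x (1# - p)))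
  E-single-true false p = +-cong (1*[x*1]≈x p) (trans (+-identityʳ _) (zeroˡ _))

  -- The gluing formula with the negative term moved to the left, so that
  -- every rearrangement below is a commutative-semiring identity.
  E-++-+ : ∀ b b' {n n'} (ρ : Vec Carrier (suc n)) (ρ' : Vec Carrier (suc n')) →
    E R b b' (ρ ++ ρ') + E R b false ρ * E R false b' ρ'
      ≈ E R b false ρ * E R true b' ρ' + E R b true ρ * E R false b' ρ'
  E-++-+ b b' (p ∷ []) ρ' = begin
    E R b b' (p ∷ ρ') + E R b false (p ∷ []) * Y
      ≈⟨ +-cong (E-∷ b b' p ρ') (*-congʳ (E-single-false b p)) ⟩
    (p * X + q * Y) + p * Y
      ≈⟨ collect p q X Y ⟩
    p * X + (p + q) * Y
      ≈⟨ sym (+-cong (*-congʳ (E-single-false b p)) (*-congʳ (E-single-true b p))) ⟩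
    E R b false (p ∷ []) * X + E R b true (p ∷ []) * Y ∎
    where
      X = E R true b' ρ'
      Y = E R false b' ρ'
      q = omitWeight b p
      collect : ∀ p q X Y → (p * X + q * Y) + p * Y ≈ p * X + (p + q) * Y
      collect = solve 4 (λ p q X Y → (p :* X :+ q :* Y) :+ p :* Y := p :* X :+ (p :+ q) :* Y) refl
  E-++-+ b b' (p ∷ ρ@(_ ∷ _)) ρ' = begin
    E R b b' (p ∷ (ρ ++ ρ')) + E R b false (p ∷ ρ) * Y
      ≈⟨ +-cong (E-∷ b b' p (ρ ++ ρ')) (*-congʳ (E-∷ b false p ρ)) ⟩
    (p * F₁ + q * F₀) + (p * A₁ + q * A₀) * Y
      ≈⟨ factor p q F₁ F₀ A₁ A₀ Y ⟩
    p * (F₁ + A₁ * Y) + q * (F₀ + A₀ * Y)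
      ≈⟨ +-cong (*-congˡ (E-++-+ true b' ρ ρ')) (*-congˡ (E-++-+ false b' ρ ρ')) ⟩
    p * (A₁ * X + B₁ * Y) + q * (A₀ * X + B₀ * Y)
      ≈⟨ expand p q A₁ A₀ B₁ B₀ X Y ⟩
    (p * A₁ + q * A₀) * X + (p * B₁ + q * B₀) * Y
      ≈⟨ sym (+-cong (*-congʳ (E-∷ b false p ρ)) (*-congʳ (E-∷ b true p ρ))) ⟩
    E R b false (p ∷ ρ) * X + E R b true (p ∷ ρ) * Y ∎
    where
      X = E R true b' ρ'
      Y = E R false b' ρ'
      q = omitWeight b p
      F₁ = E R true b' (ρ ++ ρ')
      F₀ = E R false b' (ρ ++ ρ')
      A₁ = E R true false ρ
      A₀ = E R false false ρ
      B₁ = E R true true ρ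
      B₀ = E R false true ρ
      factor : ∀ p q F₁ F₀ A₁ A₀ Y →
        (p * F₁ + q * F₀) + (p * A₁ + q * A₀) * Y ≈ p * (F₁ + A₁ * Y) + q * (F₀ + A₀ * Y)
      factor = solve 7 (λ p q F₁ F₀ A₁ A₀ Y →
        (p :* F₁ :+ q :* F₀) :+ (p :* A₁ :+ q :* A₀) :* Y
          := p :* (F₁ :+ A₁ :* Y) :+ q :* (F₀ :+ A₀ :* Y)) refl
      expand : ∀ p q A₁ A₀ B₁ B₀ X Y →
        p * (A₁ * X + B₁ * Y) + q * (A₀ * X + B₀ * Y) ≈ (p * A₁ + q * A₀) * X + (p * B₁ + q * B₀) * Y
      expand = solve 8 (λ p q A₁ A₀ B₁ B₀ X Y →
        p :* (A₁ :* X :+ B₁ :* Y) :+ q :* (A₀ :* X :+ B₀ :* Y)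
          := (p :* A₁ :+ q :* A₀) :* X :+ (p :* B₁ :+ q :* B₀) :* Y) refl

lemma20 : {c ℓ : Level} (R : CommutativeRing c ℓ) →
    let open CommutativeRing R in
    (n n' : ℕ) (ρ : Vec Carrier (suc n)) (ρ' : Vec Carrier (suc n')) (b b' : Bool) →
    E R b b' (ρ ++ ρ')
      ≈ ((E R b false ρ * E R true b' ρ' + E R b true ρ * E R false b' ρ')
          - E R b false ρ * E R false b' ρ')
lemma20 R n n' ρ ρ' b b' = x≈z//y _ _ _ (E-++-+ R b b' ρ ρ')
  where open GroupProperties (CommutativeRing.+-group R) using (x≈z//y)
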